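{- Let $M$ be a maximal path-like map such that $\mathbf{P}_{VEF}(M)$ has a realizer $\{L_1,L_2,L_3\}$, fix an angle coloring induced by this realizer and the resulting oriented coloring of the chordal edges. Then every vertex is either a sink or a source with respect to the orientation of the chordal edges (i.e., the chordal edges at a vertex are either all oriented towards it or all oriented away from it).
   Context: A planar map consists of a finite planar multigraph with a plane drawing; $\mathbf{P}_{VEF}(M)$ is the poset on vertices, edges and faces ordered by incidence/inclusion. A realizer of a poset is a family of linear extensions whose intersection is the poset; a pair $(a,b)$ is reversed in $L$ if $b<a$ in $L$. A simple 2-connected outerplanar map has a unique Hamilton cycle; its edges are cycle edges, the rest chordal edges. $M$ is path-like if its interior dual is a simple path (then the Hamilton cycle bounds the outer face), and maximal path-like if in addition every bounded face is a triangle. An inner angle is a pair $(u,T)$, $T$ an interior triangle with vertices $u,v,w$; its critical pair is $(u,vw)$ if $vw$ is a cycle edge and $(u,F)$, $F$ the other interior face containing $vw$, if $vw$ is chordal. An angle coloring induced by the realizer assigns to each inner angle a color $i\in\{1,2,3\}$ such that its critical pair is reversed in $L_i$. For a chordal edge $\{a,b\}$ lying in triangles $T_\ell,T_r$, among the four angles of $T_\ell,T_r$ at $a$ and at $b$ exactly one color occurs twice, namely as the two angles at a single endpoint; the oriented coloring gives the chordal edge this color and orients it towards that endpoint. -}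

module Defs where

open import Data.Nat as ℕ using (ℕ; zero; suc)
open import Data.Fin using (Fin; toℕ; _<_)
open import Data.Product using (Σ; ∃; _×_; _,_)
open import Data.Sum using (_⊎_)
open import Data.Unit using (⊤)
open import Relation.Nullary using (¬_)
open import Relation.Binary.PropositionalEquality using (_≡_; _≢_)
open import Function.Bundles using (_⇔_)

-- Encoding convention: the vertices of M are Fin n, numbered 0,1,…,n-1 along
-- the Hamilton cycle, which bounds the outer face.  Unordered pairs / triples
-- of vertices are always written sorted (a < b, resp. a < b < c).

CycEdge : {n : ℕ} → Fin n → Fin n → Set
CycEdge {n} a b = (suc (toℕ a) ≡ toℕ b) ⊎ (toℕ a ≡ 0 × suc (toℕ b) ≡ n)

Crosses : {n : ℕ} → Fin n → Fin n → Fin n → Fin n → Set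
Crosses a b c d = (a < c × c < b × b < d) ⊎ (c < a × a < d × d < b)

In3 : {n : ℕ} → Fin n → Fin n → Fin n → Fin n → Set
In3 x a b c = (x ≡ a) ⊎ (x ≡ b) ⊎ (x ≡ c)

-- A simple 2-connected outerplanar map with Hamilton cycle 0-1-…-(n-1)-0
-- bounding the outer face, given by its set of chordal edges.
record OuterplanarMap (n : ℕ) : Set₁ where
  field
    three≤n        : 3 ℕ.≤ n
    Chord          : Fin n → Fin n → Set
    chord-sorted   : ∀ {a b} → Chord a b → a < b
    chord-notCycle : ∀ {a b} → Chord a b → ¬ CycEdge a b
    noncrossing    : ∀ {a b c d} → Chord a b → Chord c d → ¬ Crosses a b c d

  Edge : Fin n → Fin n → Set
  Edge a b = a < b × (CycEdge a b ⊎ Chord a b)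

  -- bounded (interior) triangular faces, sorted triples
  ITri : Fin n → Fin n → Fin n → Set
  ITri a b c = Edge a b × Edge b c × Edge a c

  ShareEdge : (Fin n × Fin n × Fin n) → (Fin n × Fin n × Fin n) → Set
  ShareEdge (a , b , c) (a' , b' , c') =
    ∃ λ x → ∃ λ y → x < y × In3 x a b c × In3 y a b c × In3 x a' b' c' × In3 y a' b' c'

-- maximal: every bounded face is a triangle (no further non-crossing chord
-- can be added); path-like: the interior dual is a simple path, i.e. the
-- interior faces can be listed as T_0,…,T_{k-1} (each exactly once) so that
-- two distinct interior faces share an edge iff they are consecutive.
record MaxPathLikeMap (n : ℕ) : Set₁ where
  field
    map : OuterplanarMap n
  open OuterplanarMap map public
  field
    maximal : ∀ a b → a < b → ¬ CycEdge a b → ¬ Chord a b →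
              ∃ λ c → ∃ λ d → Chord c d × Crosses a b c d
    k       : ℕ
    tri     : Fin k → Fin n × Fin n × Fin n
    tri-face : ∀ i → let (a , b , c) = tri i in ITri a b c
    tri-onto : ∀ a b c → ITri a b c → ∃ λ i → tri i ≡ (a , b , c)
    tri-inj  : ∀ i j → tri i ≡ tri j → i ≡ j
    dual-path : ∀ i j → i ≢ j →
                ShareEdge (tri i) (tri j) ⇔ ((suc (toℕ i) ≡ toℕ j) ⊎ (suc (toℕ j) ≡ toℕ i))

module _ {n : ℕ} (M : MaxPathLikeMap n) where
  open MaxPathLikeMap M

  -- elements of P_VEF(M): vertices, edges (sorted pairs), bounded faces
  -- (sorted triples) and the outer face
  data Elem : Set where
    V : Fin n → Elem
    E : Fin n → Fin n → Elem
    F : Fin n → Fin n → Fin n → Elem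
    O : Elem

  Valid : Elem → Set
  Valid (V _)     = ⊤
  Valid (E a b)   = Edge a b
  Valid (F a b c) = ITri a b c
  Valid O         = ⊤

  data _≺_ : Elem → Elem → Set where
    ve₁ : ∀ {a b} → V a ≺ E a b
    ve₂ : ∀ {a b} → V b ≺ E a b
    vf  : ∀ {x a b c} → In3 x a b c → V x ≺ F a b c
    ef  : ∀ {x y a b c} → In3 x a b c → In3 y a b c → E x y ≺ F a b c
    vo  : ∀ {x} → V x ≺ O
    eo  : ∀ {x y} → CycEdge x y → E x y ≺ O

  -- a realizer {L₁,L₂,L₃}: each Lᵢ is a linear order on the elements, given by
  -- an injective rank function (x before y in Lᵢ iff rank i x < rank i y)
  record Realizer : Set where
    field
      rank    : Fin 3 → Elem → ℕ
      injective : ∀ i x y → Valid x → Valid y → rank i x ≡ rank i y → x ≡ y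
      extension : ∀ i x y → Valid x → Valid y → x ≺ y → rank i x ℕ.< rank i y
      realizes  : ∀ x y → Valid x → Valid y → (∀ i → rank i x ℕ.< rank i y) → x ≺ y

  -- a colouring assigns to the inner angle (u, T), T = abc, the colour col u a b c
  AngleCol : Set
  AngleCol = Fin n → Fin n → Fin n → Fin n → Fin 3

  -- the angle colouring is induced by the realizer: the critical pair of every
  -- inner angle (u,T) is reversed in L_{col(u,T)}
  InducedBy : Realizer → AngleCol → Set
  InducedBy R col =
    ∀ u a b c → ITri a b c → In3 u a b c →
    ∀ v w → v < w → In3 v a b c → In3 w a b c → v ≢ u → w ≢ u →
      (CycEdge v w → rank (col u a b c) (E v w) ℕ.< rank (col u a b c) (V u)) ×
      (Chord v w → ∀ a' b' c' → ITri a' b' c' → In3 v a' b' c' → In3 w a' b' c' →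
         (a' , b' , c') ≢ (a , b , c) →
         rank (col u a b c) (F a' b' c') ℕ.< rank (col u a b c) (V u))
    where open Realizer R

  -- the chordal edge {x,y} is oriented towards x: the two angles at x in the
  -- two triangles T_ℓ, T_r containing {x,y} receive the same colour
  OrientedTowards : AngleCol → Fin n → Fin n → Set
  OrientedTowards col x y =
    ∀ a b c a' b' c' → ITri a b c → ITri a' b' c' →
      In3 x a b c → In3 y a b c → In3 x a' b' c' → In3 y a' b' c' →
      (a , b , c) ≢ (a' , b' , c') →
      col x a b c ≡ col x a' b' c'

  ChordAt : Fin n → Fin n → Set
  ChordAt x y = Chord x y ⊎ Chord y x

  Sink : AngleCol → Fin n → Set
  Sink col x = ∀ y → ChordAt x y → OrientedTowards col x y

  Source : AngleCol → Fin n → Set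
  Source col x = ∀ y → ChordAt x y → OrientedTowards col y x

-- Let c be the colour of the corner u of a triangle T.  The critical pair of
-- (u, T) (the opposite edge, or the face across it when it is a chord) lies
-- above the other two corners of T and below u in L_c, so u is the top corner
-- of T in L_c.  Hence the three corners of a triangle get three colours, and
-- across a chord exactly one endpoint keeps its colour: if both did, the two
-- apexes would share a colour, and in that order each face would lie below the
-- other triangle's apex, hence below the other face.
--
-- Fix a vertex x.  The triangles containing x are consecutive on the dual path,
-- because the edge shared by two consecutive triangles separates the earlier
-- triangles from the later ones.  If, for consecutive triangles T_p, T, T_q
-- around x, the chord xp were not oriented towards x but xq were, the colours
-- are forced so that in each L_c some corner lies above a face containing xq;
-- then xq precedes the outer face in the whole realizer, which only cycle
-- edges do.  So all chords at x are oriented alike.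
module Submission where

open import Defs
open import Data.Nat using (ℕ)
open import Data.Fin using (Fin)
open import Data.Sum using (_⊎_)
open import Data.Empty using (⊥; ⊥-elim)
open import Data.Unit using (tt)
open import Data.Nat as ℕ using (zero; suc; _∸_; _+_)
import Data.Nat.Properties as ℕₚ
open import Data.Nat.Induction using (<-wellFounded)
open import Data.Fin as F using (toℕ; fromℕ<; _<_; _≤_)
open import Data.Fin.Properties
  using (_≟_; all?; <-cmp; <-irrefl; <-asym; <-trans; <⇒≢; ≤-refl; ≤-antisym; toℕ<n; toℕ-fromℕ<; toℕ-injective)
open import Data.Product using (∃; ∃₂; _×_; _,_; proj₁; proj₂)
import Data.Product as Prod
open import Data.Sum as Sum using (inj₁; inj₂; [_,_]′; swap)
open import Function using (_∘_; id)
open import Function.Bundles using (Equivalence; _⇔_; mk⇔)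
open import Function.Properties.Equivalence using (⇔-isEquivalence)
open import Induction.WellFounded using (Acc; acc)
open import Relation.Binary.Definitions using (Tri; tri<; tri≈; tri>)
open import Relation.Binary.Structures using (IsEquivalence)
open import Relation.Binary.PropositionalEquality
open import Relation.Nullary using (¬_; Dec; yes; no; ¬?)
open import Relation.Nullary.Decidable using (decidable-stable; _⊎-dec_; _→-dec_)

In2 : ∀ {n} → Fin n → Fin n → Fin n → Set
In2 x p q = x ≡ p ⊎ x ≡ q

module _ {n : ℕ} {a b c : Fin n} where

  In3-rotate : ∀ {u} → In3 u a b c → ∃₂ λ p q → ∀ {y} → In3 y a b c → In3 y u p q
  In3-rotate (inj₁ refl)        = b , c , id
  In3-rotate (inj₂ (inj₁ refl)) = a , c , [ inj₂ ∘ inj₁ , [ inj₁ , inj₂ ∘ inj₂ ]′ ]′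
  In3-rotate (inj₂ (inj₂ refl)) = a , b , [ inj₂ ∘ inj₁ , [ inj₂ ∘ inj₂ , inj₁ ]′ ]′

  In3-trans : ∀ {x u v w} → In3 x u v w → In3 u a b c → In3 v a b c → In3 w a b c → In3 x a b c
  In3-trans (inj₁ refl)        u∈ _  _  = u∈
  In3-trans (inj₂ (inj₁ refl)) _  v∈ _  = v∈
  In3-trans (inj₂ (inj₂ refl)) _  _  w∈ = w∈

  In3-first : ∀ {x} → In3 x a b c → x ≢ b → x ≢ c → x ≡ a
  In3-first (inj₁ x≡a)        _   _   = x≡a
  In3-first (inj₂ (inj₁ x≡b)) x≢b _   = ⊥-elim (x≢b x≡b)
  In3-first (inj₂ (inj₂ x≡c)) _   x≢c = ⊥-elim (x≢c x≡c)

  In3-second : ∀ {x} → In3 x a b c → x ≢ a → x ≢ c → x ≡ b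
  In3-second (inj₁ x≡a)        x≢a _   = ⊥-elim (x≢a x≡a)
  In3-second (inj₂ (inj₁ x≡b)) _   _   = x≡b
  In3-second (inj₂ (inj₂ x≡c)) _   x≢c = ⊥-elim (x≢c x≡c)

  In3-third : ∀ {x} → In3 x a b c → x ≢ a → x ≢ b → x ≡ c
  In3-third (inj₁ x≡a)        x≢a _   = ⊥-elim (x≢a x≡a)
  In3-third (inj₂ (inj₁ x≡b)) _   x≢b = ⊥-elim (x≢b x≡b)
  In3-third (inj₂ (inj₂ x≡c)) _   _   = x≡c

module _ {n : ℕ} {p q : Fin n} where

  In2-exhausted : ∀ {v w x} → In2 v p q → In2 w p q → v ≢ w → In2 x p q → In2 x v w
  In2-exhausted (inj₁ refl) (inj₁ refl) v≢w _  = ⊥-elim (v≢w refl)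
  In2-exhausted (inj₁ refl) (inj₂ refl) _   x∈ = x∈
  In2-exhausted (inj₂ refl) (inj₁ refl) _   x∈ = swap x∈
  In2-exhausted (inj₂ refl) (inj₂ refl) v≢w _  = ⊥-elim (v≢w refl)

  In2-sorted : ∀ {s t} → p < q → s < t → In2 s p q → In2 t p q → s ≡ p × t ≡ q
  In2-sorted p<q s<t (inj₁ refl) (inj₁ refl) = ⊥-elim (<-irrefl refl s<t)
  In2-sorted p<q s<t (inj₁ refl) (inj₂ refl) = refl , refl
  In2-sorted p<q s<t (inj₂ refl) (inj₁ refl) = ⊥-elim (<-asym p<q s<t)
  In2-sorted p<q s<t (inj₂ refl) (inj₂ refl) = ⊥-elim (<-irrefl refl s<t)

In3-exhausted : ∀ {n} {u v w x a b c : Fin n} → In3 u a b c → In3 v a b c → In3 w a b c →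
                u ≢ v → u ≢ w → v ≢ w → In3 x a b c → In3 x u v w
In3-exhausted {u = u} u∈ v∈ w∈ u≢v u≢w v≢w x∈ with In3-rotate u∈
... | p , q , rotate with rotate x∈
...   | inj₁ x≡u  = inj₁ x≡u
...   | inj₂ x∈pq = inj₂ (In2-exhausted (drop (rotate v∈) (≢-sym u≢v)) (drop (rotate w∈) (≢-sym u≢w)) v≢w x∈pq)
  where
  drop : ∀ {y} → In3 y u p q → y ≢ u → In2 y p q
  drop (inj₁ y≡u) y≢u = ⊥-elim (y≢u y≡u)
  drop (inj₂ y∈)  _   = y∈

In3-between : ∀ {n} {x a b c : Fin n} → a < b → b < c → In3 x a b c → a ≤ x × x ≤ c
In3-between a<b b<c (inj₁ refl)        = ≤-refl , ℕₚ.<⇒≤ (<-trans a<b b<c)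
In3-between a<b b<c (inj₂ (inj₁ refl)) = ℕₚ.<⇒≤ a<b , ℕₚ.<⇒≤ b<c
In3-between a<b b<c (inj₂ (inj₂ refl)) = ℕₚ.<⇒≤ (<-trans a<b b<c) , ≤-refl

sorted-triple-unique : ∀ {n} {a b c a′ b′ c′ : Fin n} → a < b → b < c → a′ < b′ → b′ < c′ →
                       In3 a a′ b′ c′ → In3 b a′ b′ c′ → In3 c a′ b′ c′ → (a , b , c) ≡ (a′ , b′ , c′)
sorted-triple-unique {a = a} {b} {c} {a′} {b′} {c′} a<b b<c a′<b′ b′<c′ a∈ b∈ c∈ =
  cong₂ _,_ a≡a′ (cong₂ _,_ b≡b′ c≡c′)
  where
  a≢b = <⇒≢ a<b
  b≢c = <⇒≢ b<c
  back : ∀ {y} → In3 y a′ b′ c′ → In3 y a b c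
  back = In3-exhausted a∈ b∈ c∈ a≢b (<⇒≢ (<-trans a<b b<c)) b≢c
  a≡a′ : a ≡ a′
  a≡a′ = ≤-antisym (proj₁ (In3-between a<b b<c (back (inj₁ refl)))) (proj₁ (In3-between a′<b′ b′<c′ a∈))
  c≡c′ : c ≡ c′
  c≡c′ = ≤-antisym (proj₂ (In3-between a′<b′ b′<c′ c∈)) (proj₂ (In3-between a<b b<c (back (inj₂ (inj₂ refl)))))
  b≡b′ : b ≡ b′
  b≡b′ = In3-second b∈ (λ b≡a′ → a≢b (trans a≡a′ (sym b≡a′))) (λ b≡c′ → b≢c (trans b≡c′ (sym c≡c′)))

Fin3-exhausted : ∀ {x y z : Fin 3} → x ≢ y → x ≢ z → y ≢ z → ∀ w → In3 w x y z
Fin3-exhausted x≢y x≢z y≢z w = In3-exhausted (all3 _) (all3 _) (all3 _) x≢y x≢z y≢z (all3 w)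
  where
  all3 : ∀ (w : Fin 3) → In3 w F.zero (F.suc F.zero) (F.suc (F.suc F.zero))
  all3 F.zero                 = inj₁ refl
  all3 (F.suc F.zero)         = inj₂ (inj₁ refl)
  all3 (F.suc (F.suc F.zero)) = inj₂ (inj₂ refl)

¬¬-descent⇒empty : ∀ {A : Set} {P : A → Set} (μ : A → ℕ) →
                   (∀ {s} → P s → ¬ ¬ (∃ λ s′ → μ s′ ℕ.< μ s × P s′)) → ∀ {s} → ¬ P s
¬¬-descent⇒empty {P = P} μ descend {s} = go (<-wellFounded (μ s))
  where
  go : ∀ {s} → Acc ℕ._<_ (μ s) → ¬ P s
  go (acc rs) Ps = descend Ps λ (_ , lt , Ps′) → go (rs lt) Ps′

Next : ∀ {m} → Fin m → Fin m → Set
Next i j = suc (toℕ i) ≡ toℕ j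

Next⇒< : ∀ {m} {i j : Fin m} → Next i j → i < j
Next⇒< {i = i} i→j = subst (toℕ i ℕ.<_) i→j (ℕₚ.n<1+n (toℕ i))

Next-unique : ∀ {m} {i j j′ : Fin m} → Next i j → Next i j′ → j ≡ j′
Next-unique i→j i→j′ = toℕ-injective (trans (sym i→j) i→j′)

successor : ∀ {m} {i : Fin m} → suc (toℕ i) ℕ.< m → ∃ (Next i)
successor 1+i<m = fromℕ< 1+i<m , sym (toℕ-fromℕ< 1+i<m)

Fin-walk : ∀ {m} (P : Fin m → Set) {a b : Fin m} → a ≤ b → P a →
           (∀ {i j} → Next i j → a ≤ i → j ≤ b → P i → P j) → P b
Fin-walk {m} P {a} {b} a≤b Pa step = go (toℕ b ∸ toℕ a) ≤-refl (sym (ℕₚ.m∸n+n≡m a≤b)) Pa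
  where
  go : ∀ d {i} → a ≤ i → toℕ b ≡ d + toℕ i → P i → P b
  go zero    _       b≡i     Pi = subst P (toℕ-injective (sym b≡i)) Pi
  go (suc d) {i} a≤i b≡1+d+i Pi = advance (successor (ℕₚ.≤-<-trans 1+i≤b (toℕ<n b)))
    where
    1+i≤b : suc (toℕ i) ℕ.≤ toℕ b
    1+i≤b = subst (suc (toℕ i) ℕ.≤_) (trans (ℕₚ.+-suc d (toℕ i)) (sym b≡1+d+i)) (ℕₚ.m≤n+m _ d)
    advance : ∃ (Next i) → P b
    advance (j , i→j) =
      go d (ℕₚ.≤-trans a≤i (ℕₚ.<⇒≤ (Next⇒< i→j)))
           (trans b≡1+d+i (trans (sym (ℕₚ.+-suc d (toℕ i))) (cong (d +_) i→j)))
           (step i→j a≤i (subst (ℕ._≤ toℕ b) i→j 1+i≤b) Pi)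

module Geometry {n : ℕ} (M : MaxPathLikeMap n) where
  open MaxPathLikeMap M

  Inside Outside : Fin n → Fin n → Fin n → Set
  Inside  a b x = a < x × x < b
  Outside a b x = x < a ⊎ b < x

  Separates : Fin n → Fin n → Fin n → Fin n → Set
  Separates a b x y = (Inside a b x × Outside a b y) ⊎ (Outside a b x × Inside a b y)

  side : ∀ {a b x} → x ≢ a → x ≢ b → Inside a b x ⊎ Outside a b x
  side {a} {b} {x} x≢a x≢b with <-cmp x a | <-cmp x b
  ... | tri< x<a _ _    | _             = inj₂ (inj₁ x<a)
  ... | tri≈ _ x≡a _    | _             = ⊥-elim (x≢a x≡a)
  ... | tri> _ _ a<x    | tri< x<b _ _  = inj₁ (a<x , x<b)
  ... | tri> _ _ _      | tri≈ _ x≡b _  = ⊥-elim (x≢b x≡b)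
  ... | tri> _ _ _      | tri> _ _ b<x  = inj₂ (inj₂ b<x)

  inside-outside-disjoint : ∀ {a b x} → Inside a b x → ¬ Outside a b x
  inside-outside-disjoint (a<x , _) (inj₁ x<a) = <-asym a<x x<a
  inside-outside-disjoint (_ , x<b) (inj₂ b<x) = <-asym x<b b<x

  separates-sym : ∀ {a b x y} → Separates a b x y → Separates a b y x
  separates-sym (inj₁ (x-in , y-out)) = inj₂ (y-out , x-in)
  separates-sym (inj₂ (x-out , y-in)) = inj₁ (y-in , x-out)

  separates⇒≢ : ∀ {a b x y} → Separates a b x y → x ≢ y
  separates⇒≢ (inj₁ (x-in , y-out)) refl = inside-outside-disjoint x-in y-out
  separates⇒≢ (inj₂ (x-out , y-in)) refl = inside-outside-disjoint y-in x-out

  separates-split : ∀ {a b x y z} → Separates a b x y → z ≢ a → z ≢ b →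
                    Separates a b x z ⊎ Separates a b z y
  separates-split (inj₁ (x-in , y-out)) z≢a z≢b with side z≢a z≢b
  ... | inj₁ z-in  = inj₂ (inj₁ (z-in , y-out))
  ... | inj₂ z-out = inj₁ (inj₁ (x-in , z-out))
  separates-split (inj₂ (x-out , y-in)) z≢a z≢b with side z≢a z≢b
  ... | inj₁ z-in  = inj₁ (inj₂ (x-out , z-in))
  ... | inj₂ z-out = inj₂ (inj₂ (z-out , y-in))

  crosses⇒separates : ∀ {a b c d} → Crosses a b c d → Separates a b c d
  crosses⇒separates (inj₁ (a<c , c<b , b<d)) = inj₁ ((a<c , c<b) , inj₂ b<d)
  crosses⇒separates (inj₂ (c<a , a<d , d<b)) = inj₂ (inj₁ c<a , (a<d , d<b))

  separates⇒crosses : ∀ {a b c d} → c < d → Separates a b c d → Crosses a b c d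
  separates⇒crosses c<d (inj₁ ((a<c , c<b) , inj₁ d<a)) = ⊥-elim (<-asym (<-trans a<c c<d) d<a)
  separates⇒crosses c<d (inj₁ ((a<c , c<b) , inj₂ b<d)) = inj₁ (a<c , c<b , b<d)
  separates⇒crosses c<d (inj₂ (inj₁ c<a , (a<d , d<b))) = inj₂ (c<a , a<d , d<b)
  separates⇒crosses c<d (inj₂ (inj₂ b<c , (a<d , d<b))) = ⊥-elim (<-asym (<-trans b<c c<d) d<b)

  cycle-edge-one-sided : ∀ {a b x y} → CycEdge a b → Inside a b x → ¬ Outside a b y
  cycle-edge-one-sided (inj₁ 1+a≡b) (a<x , x<b) _ =
    ℕₚ.<⇒≱ a<x (ℕₚ.≤-pred (subst (suc (toℕ _) ℕ.≤_) (sym 1+a≡b) x<b))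
  cycle-edge-one-sided (inj₂ (a≡0 , _))       _ (inj₁ y<a) = ℕₚ.n≮0 (subst (toℕ _ ℕ.<_) a≡0 y<a)
  cycle-edge-one-sided {y = y} (inj₂ (_ , 1+b≡n)) _ (inj₂ b<y) =
    ℕₚ.<⇒≱ b<y (ℕₚ.≤-pred (subst (suc (toℕ y) ℕ.≤_) (sym 1+b≡n) (toℕ<n y)))

  cycle-edge-uncrossed : ∀ {a b c d} → CycEdge a b → ¬ Crosses a b c d
  cycle-edge-uncrossed ab crosses with crosses⇒separates crosses
  ... | inj₁ (c-in , d-out) = cycle-edge-one-sided ab c-in d-out
  ... | inj₂ (c-out , d-in) = cycle-edge-one-sided ab d-in c-out

  edges-noncrossing : ∀ {a b c d} → Edge a b → Edge c d → ¬ Crosses a b c d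
  edges-noncrossing (_ , inj₁ ab) _              = cycle-edge-uncrossed ab
  edges-noncrossing (_ , inj₂ _)  (_ , inj₁ cd)  = cycle-edge-uncrossed cd ∘ swap
  edges-noncrossing (_ , inj₂ ab) (_ , inj₂ cd)  = noncrossing ab cd

  chord-edge : ∀ {a b} → Chord a b → Edge a b
  chord-edge ab = chord-sorted ab , inj₂ ab

  -- Chord is an arbitrary predicate, so edges are found only under ¬ ¬.
  edge-or-crossed : ∀ {a b} → a < b → ¬ ¬ (Edge a b ⊎ ∃₂ λ c d → Chord c d × Crosses a b c d)
  edge-or-crossed {a} {b} a<b k =
    k (inj₂ (maximal a b a<b (k ∘ inj₁ ∘ (a<b ,_) ∘ inj₁) (k ∘ inj₁ ∘ (a<b ,_) ∘ inj₂)))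

  A B C : Fin k → Fin n
  A i = proj₁ (tri i)
  B i = proj₁ (proj₂ (tri i))
  C i = proj₂ (proj₂ (tri i))

  _∈T_ : Fin n → Fin k → Set
  x ∈T i = In3 x (A i) (B i) (C i)

  A<B : ∀ i → A i < B i
  A<B i = proj₁ (proj₁ (tri-face i))

  B<C : ∀ i → B i < C i
  B<C i = proj₁ (proj₁ (proj₂ (tri-face i)))

  A<C : ∀ i → A i < C i
  A<C i = <-trans (A<B i) (B<C i)

  triangle-edge : ∀ {i u v} → u ∈T i → v ∈T i → u < v → Edge u v
  triangle-edge {i} (inj₁ refl)        (inj₂ (inj₁ refl)) _   = proj₁ (tri-face i)
  triangle-edge {i} (inj₁ refl)        (inj₂ (inj₂ refl)) _   = proj₂ (proj₂ (tri-face i))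
  triangle-edge {i} (inj₂ (inj₁ refl)) (inj₂ (inj₂ refl)) _   = proj₁ (proj₂ (tri-face i))
  triangle-edge     (inj₁ refl)        (inj₁ refl)        u<v = ⊥-elim (<-irrefl refl u<v)
  triangle-edge {i} (inj₂ (inj₁ refl)) (inj₁ refl)        u<v = ⊥-elim (<-asym u<v (A<B i))
  triangle-edge     (inj₂ (inj₁ refl)) (inj₂ (inj₁ refl)) u<v = ⊥-elim (<-irrefl refl u<v)
  triangle-edge {i} (inj₂ (inj₂ refl)) (inj₁ refl)        u<v = ⊥-elim (<-asym u<v (A<C i))
  triangle-edge {i} (inj₂ (inj₂ refl)) (inj₂ (inj₁ refl)) u<v = ⊥-elim (<-asym u<v (B<C i))
  triangle-edge     (inj₂ (inj₂ refl)) (inj₂ (inj₂ refl)) u<v = ⊥-elim (<-irrefl refl u<v)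

  triangle-not-separated : ∀ {a b i y z} → Edge a b → y ∈T i → z ∈T i → ¬ Separates a b y z
  triangle-not-separated {y = y} {z} ab y∈ z∈ sep with <-cmp y z
  ... | tri< y<z _ _ = edges-noncrossing ab (triangle-edge y∈ z∈ y<z) (separates⇒crosses y<z sep)
  ... | tri≈ _ y≡z _ = separates⇒≢ sep y≡z
  ... | tri> _ _ z<y = edges-noncrossing ab (triangle-edge z∈ y∈ z<y) (separates⇒crosses z<y (separates-sym sep))

  vertex-avoiding : ∀ i u v → ∃ λ w → w ∈T i × w ≢ u × w ≢ v
  vertex-avoiding i u v with A i ≟ u | A i ≟ v | B i ≟ u | B i ≟ v
  ... | no A≢u | no A≢v | _ | _ = A i , inj₁ refl , A≢u , A≢v
  ... | yes refl | _ | no B≢u | no B≢v = B i , inj₂ (inj₁ refl) , B≢u , B≢v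
  ... | no _ | yes refl | no B≢u | no B≢v = B i , inj₂ (inj₁ refl) , B≢u , B≢v
  ... | yes refl | _ | yes B≡u | _ = ⊥-elim (<⇒≢ (A<B i) (sym B≡u))
  ... | no _ | yes refl | _ | yes B≡v = ⊥-elim (<⇒≢ (A<B i) (sym B≡v))
  ... | yes refl | _ | no _ | yes refl = C i , inj₂ (inj₂ refl) , <⇒≢ (A<C i) ∘ sym , <⇒≢ (B<C i) ∘ sym
  ... | no _ | yes refl | yes refl | _ = C i , inj₂ (inj₂ refl) , <⇒≢ (B<C i) ∘ sym , <⇒≢ (A<C i) ∘ sym

  same-triangle : ∀ {i j u v w} → u ∈T i → v ∈T i → w ∈T i → u ∈T j → v ∈T j → w ∈T j →
                  u ≢ v → u ≢ w → v ≢ w → i ≡ j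
  same-triangle {i} {j} ui vi wi uj vj wj u≢v u≢w v≢w =
    tri-inj i j (sorted-triple-unique (A<B i) (B<C i) (A<B j) (B<C j)
                   (into-j (inj₁ refl)) (into-j (inj₂ (inj₁ refl))) (into-j (inj₂ (inj₂ refl))))
    where
    into-j : ∀ {x} → x ∈T i → x ∈T j
    into-j x∈ = In3-trans (In3-exhausted ui vi wi u≢v u≢w v≢w x∈) uj vj wj

  triangle-index : ∀ {a b c} → ITri a b c → ∃ λ i → a ∈T i × b ∈T i × c ∈T i
  triangle-index {a} {b} {c} t with tri-onto a b c t
  ... | i , tri≡abc = i , inj₁ (sym (cong proj₁ tri≡abc)) , inj₂ (inj₁ (sym (cong (proj₁ ∘ proj₂) tri≡abc))) ,
                      inj₂ (inj₂ (sym (cong (proj₂ ∘ proj₂) tri≡abc)))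

  -- A neighbour s of p walks from p+1 towards q until sq is an edge: a chord
  -- crossing sq must start at p (else it crosses pq or ps), and carries s on.
  chord-apex-inside : ∀ {p q} → Chord p q → ¬ ¬ (∃ λ r → ITri p r q)
  chord-apex-inside {p} {q} pq found = start (successor (ℕₚ.<-trans p+1<q (toℕ<n q)))
    where
    Walker : Fin n → Set
    Walker s = p < s × s < q × Edge p s
    descend : ∀ {s} → Walker s → ¬ ¬ (∃ λ s′ → toℕ q ∸ toℕ s′ ℕ.< toℕ q ∸ toℕ s × Walker s′)
    descend {s} (p<s , s<q , ps) step = edge-or-crossed s<q λ
      { (inj₁ sq) → found (s , ps , sq , chord-edge pq)
      ; (inj₂ (c , d , cd , inj₁ (s<c , c<q , q<d))) → noncrossing pq cd (inj₁ (<-trans p<s s<c , c<q , q<d))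
      ; (inj₂ (c , d , cd , inj₂ (c<s , s<d , d<q))) → pivot cd c<s s<d d<q (<-cmp c p) }
      where
      pivot : ∀ {c d} → Chord c d → c < s → s < d → d < q → Tri (c < p) (c ≡ p) (p < c) → ⊥
      pivot cd c<s s<d d<q (tri< c<p _ _) = noncrossing pq cd (inj₂ (c<p , <-trans p<s s<d , d<q))
      pivot cd c<s s<d d<q (tri> _ _ p<c) = edges-noncrossing ps (chord-edge cd) (inj₁ (p<c , c<s , s<d))
      pivot cd c<s s<d d<q (tri≈ _ refl _) =
        step (_ , ℕₚ.∸-monoʳ-< s<d (ℕₚ.<⇒≤ d<q) , <-trans p<s s<d , d<q , chord-edge cd)
    p+1<q : suc (toℕ p) ℕ.< toℕ q
    p+1<q with ℕₚ.m≤n⇒m<n∨m≡n (chord-sorted pq)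
    ... | inj₁ p+1<q = p+1<q
    ... | inj₂ p+1≡q = ⊥-elim (chord-notCycle pq (inj₁ p+1≡q))
    start : ∃ (Next p) → ⊥
    start (s , p→s) = ¬¬-descent⇒empty (λ s → toℕ q ∸ toℕ s) descend
      (Next⇒< p→s , subst (ℕ._< toℕ q) p→s p+1<q , Next⇒< p→s , inj₁ (inj₁ p→s))

  -- The same walk on the other side of ac: a neighbour of c starts at c+1,
  -- climbs to n-1, wraps around to 0 and climbs towards a.
  chord-apex-outside : ∀ {a c} → Chord a c → ¬ ¬ (∃ λ r → ITri r a c ⊎ ITri a c r)
  chord-apex-outside {a} {c} ac found = start (ℕₚ.m≤n⇒m<n∨m≡n (toℕ<n c))
    where
    a<c = chord-sorted ac
    LowWalker HighWalker : Fin n → Set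
    LowWalker  s = s < a × Edge s c
    HighWalker s = c < s × Edge c s
    low : ∀ {s} → ¬ LowWalker s
    low = ¬¬-descent⇒empty (λ s → toℕ a ∸ toℕ s) descend
      where
      descend : ∀ {s} → LowWalker s → ¬ ¬ (∃ λ s′ → toℕ a ∸ toℕ s′ ℕ.< toℕ a ∸ toℕ s × LowWalker s′)
      descend {s} (s<a , sc) step = edge-or-crossed s<a λ
        { (inj₁ sa) → found (s , inj₁ (sa , chord-edge ac , sc))
        ; (inj₂ (u , v , uv , inj₂ (u<s , s<v , v<a))) →
            edges-noncrossing sc (chord-edge uv) (inj₂ (u<s , s<v , <-trans v<a a<c))
        ; (inj₂ (u , v , uv , inj₁ (s<u , u<a , a<v))) → pivot uv s<u u<a a<v (<-cmp v c) }
        where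
        pivot : ∀ {u v} → Chord u v → s < u → u < a → a < v → Tri (v < c) (v ≡ c) (c < v) → ⊥
        pivot uv s<u u<a a<v (tri< v<c _ _) = noncrossing ac uv (inj₂ (u<a , a<v , v<c))
        pivot uv s<u u<a a<v (tri> _ _ c<v) =
          edges-noncrossing sc (chord-edge uv) (inj₁ (s<u , <-trans u<a a<c , c<v))
        pivot uv s<u u<a a<v (tri≈ _ refl _) = step (_ , ℕₚ.∸-monoʳ-< s<u (ℕₚ.<⇒≤ u<a) , u<a , chord-edge uv)
    high : ∀ {s} → ¬ HighWalker s
    high = ¬¬-descent⇒empty (λ s → n ∸ toℕ s) descend
      where
      descend : ∀ {s} → HighWalker s → ¬ ¬ (∃ λ s′ → n ∸ toℕ s′ ℕ.< n ∸ toℕ s × HighWalker s′)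
      descend {s} (c<s , cs) step = edge-or-crossed (<-trans a<c c<s) λ
        { (inj₁ as) → found (s , inj₂ (chord-edge ac , cs , as))
        ; (inj₂ (u , v , uv , inj₁ (a<u , u<s , s<v))) → pivot₁ uv a<u u<s s<v (<-cmp u c)
        ; (inj₂ (u , v , uv , inj₂ (u<a , a<v , v<s))) → pivot₂ uv u<a a<v v<s (<-cmp v c) }
        where
        pivot₁ : ∀ {u v} → Chord u v → a < u → u < s → s < v → Tri (u < c) (u ≡ c) (c < u) → ⊥
        pivot₁ uv a<u u<s s<v (tri< u<c _ _) = noncrossing ac uv (inj₁ (a<u , u<c , <-trans c<s s<v))
        pivot₁ uv a<u u<s s<v (tri> _ _ c<u) = edges-noncrossing cs (chord-edge uv) (inj₁ (c<u , u<s , s<v))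
        pivot₁ {v = v} uv a<u u<s s<v (tri≈ _ refl _) =
          step (_ , ℕₚ.∸-monoʳ-< s<v (ℕₚ.<⇒≤ (toℕ<n v)) , <-trans c<s s<v , chord-edge uv)
        pivot₂ : ∀ {u v} → Chord u v → u < a → a < v → v < s → Tri (v < c) (v ≡ c) (c < v) → ⊥
        pivot₂ uv u<a a<v v<s (tri< v<c _ _) = noncrossing ac uv (inj₂ (u<a , a<v , v<c))
        pivot₂ uv u<a a<v v<s (tri> _ _ c<v) =
          edges-noncrossing cs (chord-edge uv) (inj₂ (<-trans u<a a<c , c<v , v<s))
        pivot₂ uv u<a a<v v<s (tri≈ _ refl _) = low (u<a , chord-edge uv)
    start : suc (toℕ c) ℕ.< n ⊎ suc (toℕ c) ≡ n → ⊥
    start (inj₁ c+1<n) with successor c+1<n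
    ... | s , c→s = high (Next⇒< c→s , Next⇒< c→s , inj₁ (inj₁ c→s))
    start (inj₂ c+1≡n) = low {s₀} (s₀<a , <-trans s₀<a a<c , inj₁ (inj₂ (s₀≡0 , c+1≡n)))
      where
      0<n = ℕₚ.≤-<-trans ℕ.z≤n (toℕ<n c)
      s₀ = fromℕ< 0<n
      s₀≡0 : toℕ s₀ ≡ 0
      s₀≡0 = toℕ-fromℕ< 0<n
      s₀<a : s₀ < a
      s₀<a = subst (ℕ._< toℕ a) (sym s₀≡0) (ℕₚ.n≢0⇒n>0 λ a≡0 → chord-notCycle ac (inj₂ (a≡0 , c+1≡n)))

  vertex-not-in⇒triangle-≢ : ∀ {i j p q x r} → p ∈T i → q ∈T i → x ∈T i → p ≢ q → p ≢ x → q ≢ x →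
                             r ∈T j → r ≢ p → r ≢ q → r ≢ x → j ≢ i
  vertex-not-in⇒triangle-≢ p∈ q∈ x∈ p≢q p≢x q≢x r∈ r≢p r≢q r≢x refl
    with In3-exhausted p∈ q∈ x∈ p≢q p≢x q≢x r∈
  ... | inj₁ r≡p        = r≢p r≡p
  ... | inj₂ (inj₁ r≡q) = r≢q r≡q
  ... | inj₂ (inj₂ r≡x) = r≢x r≡x

  triangle-across-chord : ∀ {i p q x a b c r} → p < q → p ∈T i → q ∈T i → x ∈T i → x ≢ p → x ≢ q →
                          ITri a b c → In3 p a b c → In3 q a b c → In3 r a b c → r ≢ p → r ≢ q →
                          Separates p q x r → ∃ λ j → j ≢ i × p ∈T j × q ∈T j
  triangle-across-chord p<q p∈ q∈ x∈ x≢p x≢q t pt qt rt r≢p r≢q x|r with triangle-index t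
  ... | j , a∈ , b∈ , c∈ =
    j , vertex-not-in⇒triangle-≢ p∈ q∈ x∈ (<⇒≢ p<q) (≢-sym x≢p) (≢-sym x≢q) (into rt) r≢p r≢q
                                  (≢-sym (separates⇒≢ x|r)) ,
    into pt , into qt
    where
    into : ∀ {y} → In3 y _ _ _ → y ∈T j
    into y∈ = In3-trans y∈ a∈ b∈ c∈

  chord-second-triangle : ∀ {i p q} → Chord p q → p ∈T i → q ∈T i → ¬ ¬ (∃ λ j → j ≢ i × p ∈T j × q ∈T j)
  chord-second-triangle {i} {p} {q} pq p∈ q∈ found with vertex-avoiding i p q
  ... | x , x∈ , x≢p , x≢q = on-side (side x≢p x≢q)
    where
    p<q = chord-sorted pq
    on-side : Inside p q x ⊎ Outside p q x → ⊥
    on-side (inj₁ x-in) = chord-apex-outside pq λ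
      { (r , inj₁ rpq@((r<p , _) , _)) →
          found (triangle-across-chord p<q p∈ q∈ x∈ x≢p x≢q rpq (inj₂ (inj₁ refl)) (inj₂ (inj₂ refl)) (inj₁ refl)
                                       (<⇒≢ r<p) (<⇒≢ (<-trans r<p p<q)) (inj₁ (x-in , inj₁ r<p)))
      ; (r , inj₂ pqr@(_ , (q<r , _) , _)) →
          found (triangle-across-chord p<q p∈ q∈ x∈ x≢p x≢q pqr (inj₁ refl) (inj₂ (inj₁ refl)) (inj₂ (inj₂ refl))
                                       (<⇒≢ (<-trans p<q q<r) ∘ sym) (<⇒≢ q<r ∘ sym) (inj₁ (x-in , inj₂ q<r))) }
    on-side (inj₂ x-out) = chord-apex-inside pq λ
      { (r , prq@((p<r , _) , (r<q , _) , _)) →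
          found (triangle-across-chord p<q p∈ q∈ x∈ x≢p x≢q prq (inj₁ refl) (inj₂ (inj₂ refl)) (inj₂ (inj₁ refl))
                                       (<⇒≢ p<r ∘ sym) (<⇒≢ r<q) (inj₂ (x-out , (p<r , r<q)))) }

  SameSide : Fin n → Fin n → Fin n → Fin n → Set
  SameSide a b x y = (Inside a b x × Inside a b y) ⊎ (Outside a b x × Outside a b y)

  apexes-not-same-side-ordered : ∀ {i j p q c d} → p < q → p ∈T i → q ∈T i → p ∈T j → q ∈T j →
                                 c ∈T i → d ∈T j → c < d → ¬ SameSide p q c d
  apexes-not-same-side-ordered p<q pi qi pj qj ci dj c<d (inj₁ ((p<c , c<q) , (p<d , d<q))) =
    edges-noncrossing (triangle-edge pj dj p<d) (triangle-edge ci qi c<q) (inj₁ (p<c , c<d , d<q))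
  apexes-not-same-side-ordered p<q pi qi pj qj ci dj c<d (inj₂ (inj₁ c<p , inj₁ d<p)) =
    edges-noncrossing (triangle-edge ci pi c<p) (triangle-edge dj qj (<-trans d<p p<q)) (inj₁ (c<d , d<p , p<q))
  apexes-not-same-side-ordered p<q pi qi pj qj ci dj c<d (inj₂ (inj₁ c<p , inj₂ q<d)) =
    edges-noncrossing (triangle-edge ci qi (<-trans c<p p<q)) (triangle-edge pj dj (<-trans p<q q<d))
                      (inj₁ (c<p , p<q , q<d))
  apexes-not-same-side-ordered p<q pi qi pj qj ci dj c<d (inj₂ (inj₂ q<c , inj₁ d<p)) =
    <-asym c<d (<-trans d<p (<-trans p<q q<c))
  apexes-not-same-side-ordered p<q pi qi pj qj ci dj c<d (inj₂ (inj₂ q<c , inj₂ q<d)) =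
    edges-noncrossing (triangle-edge pi ci (<-trans p<q q<c)) (triangle-edge qj dj q<d) (inj₁ (p<q , q<c , c<d))

  apexes-not-same-side : ∀ {i j p q c d} → i ≢ j → p < q → p ∈T i → q ∈T i → p ∈T j → q ∈T j →
                         c ∈T i → d ∈T j → c ≢ p → c ≢ q → ¬ SameSide p q c d
  apexes-not-same-side {c = c} {d} i≢j p<q pi qi pj qj ci dj c≢p c≢q same with <-cmp c d
  ... | tri< c<d _ _  = apexes-not-same-side-ordered p<q pi qi pj qj ci dj c<d same
  ... | tri≈ _ refl _ = i≢j (same-triangle pi qi ci pj qj dj (<⇒≢ p<q) (≢-sym c≢p) (≢-sym c≢q))
  ... | tri> _ _ d<c  = apexes-not-same-side-ordered p<q pj qj pi qi dj ci d<c (Sum.map Prod.swap Prod.swap same)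

  apexes-separated : ∀ {i j p q c d} → i ≢ j → p < q → p ∈T i → q ∈T i → p ∈T j → q ∈T j →
                     c ∈T i → d ∈T j → c ≢ p → c ≢ q → d ≢ p → d ≢ q → Separates p q c d
  apexes-separated i≢j p<q pi qi pj qj ci dj c≢p c≢q d≢p d≢q with side c≢p c≢q | side d≢p d≢q
  ... | inj₁ c-in  | inj₂ d-out = inj₁ (c-in , d-out)
  ... | inj₂ c-out | inj₁ d-in  = inj₂ (c-out , d-in)
  ... | inj₁ c-in  | inj₁ d-in  =
    ⊥-elim (apexes-not-same-side i≢j p<q pi qi pj qj ci dj c≢p c≢q (inj₁ (c-in , d-in)))
  ... | inj₂ c-out | inj₂ d-out =
    ⊥-elim (apexes-not-same-side i≢j p<q pi qi pj qj ci dj c≢p c≢q (inj₂ (c-out , d-out)))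

  shared-edge-chord : ∀ {i j p q} → i ≢ j → p < q → p ∈T i → q ∈T i → p ∈T j → q ∈T j → Chord p q
  shared-edge-chord {i} {j} {p} {q} i≢j p<q pi qi pj qj with proj₂ (triangle-edge pi qi p<q)
  ... | inj₂ pq = pq
  ... | inj₁ pq with vertex-avoiding i p q | vertex-avoiding j p q
  ...   | c , ci , c≢p , c≢q | d , dj , d≢p , d≢q
          with apexes-separated i≢j p<q pi qi pj qj ci dj c≢p c≢q d≢p d≢q
  ...     | inj₁ (c-in , d-out) = ⊥-elim (cycle-edge-one-sided pq c-in d-out)
  ...     | inj₂ (c-out , d-in) = ⊥-elim (cycle-edge-one-sided pq d-in c-out)

  SharedEdge : Fin k → Fin k → Set
  SharedEdge i j = ∃₂ λ s t → s < t × s ∈T i × t ∈T i × s ∈T j × t ∈T j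

  consecutive-share-edge : ∀ {i j} → Next i j → SharedEdge i j
  consecutive-share-edge {i} {j} i→j = Equivalence.from (dual-path i j (<⇒≢ (Next⇒< i→j))) (inj₁ i→j)

  sharing-edge⇒consecutive : ∀ {i j s t} → i ≢ j → s ≢ t → s ∈T i → t ∈T i → s ∈T j → t ∈T j →
                             Next i j ⊎ Next j i
  sharing-edge⇒consecutive {i} {j} {s} {t} i≢j s≢t si ti sj tj with <-cmp s t
  ... | tri< s<t _ _  = Equivalence.to (dual-path i j i≢j) (s , t , s<t , si , ti , sj , tj)
  ... | tri≈ _ s≡t _ = ⊥-elim (s≢t s≡t)
  ... | tri> _ _ t<s  = Equivalence.to (dual-path i j i≢j) (t , s , t<s , ti , si , tj , sj)

  consecutive-share-edge-at : ∀ {l l′ x} → Next l l′ → x ∈T l → x ∈T l′ →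
                              ∃ λ p → p ≢ x × p ∈T l × p ∈T l′
  consecutive-share-edge-at {x = x} l→l′ xl xl′ with consecutive-share-edge l→l′
  ... | s , t , s<t , sl , tl , sl′ , tl′ with x ≟ s | x ≟ t
  ...   | yes refl | _        = t , <⇒≢ s<t ∘ sym , tl , tl′
  ...   | no _     | yes refl = s , <⇒≢ s<t , sl , sl′
  ...   | no x≢s   | no x≢t   =
          ⊥-elim (<⇒≢ (Next⇒< l→l′) (same-triangle sl tl xl sl′ tl′ xl′ (<⇒≢ s<t) (≢-sym x≢s) (≢-sym x≢t)))

  common-vertex-on-edge : ∀ {u v w w′ y m m′} → Edge u v → Separates u v w′ w → w′ ∈T m′ → w ∈T m →
                          y ∈T m → y ∈T m′ → In2 y u v
  common-vertex-on-edge {u} {v} {y = y} uv w′|w w′m′ wm ym ym′ with y ≟ u | y ≟ v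
  ... | yes y≡u | _       = inj₁ y≡u
  ... | no _    | yes y≡v = inj₂ y≡v
  ... | no y≢u  | no y≢v  with separates-split w′|w y≢u y≢v
  ...   | inj₁ w′|y = ⊥-elim (triangle-not-separated uv w′m′ ym′ w′|y)
  ...   | inj₂ y|w  = ⊥-elim (triangle-not-separated uv ym wm y|w)

  separation-persists : ∀ {u v x w m m′} → Edge u v → Next m m′ → ¬ (u ∈T m′ × v ∈T m′) →
                        Separates u v x w → w ∈T m → ∃ λ w′ → w′ ∈T m′ × Separates u v x w′
  separation-persists {u} {v} {m′ = m′} uv m→m′ ¬uv x|w wm with vertex-avoiding m′ u v
  ... | w′ , w′m′ , w′≢u , w′≢v with separates-split x|w w′≢u w′≢v
  ...   | inj₁ x|w′ = w′ , w′m′ , x|w′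
  ...   | inj₂ w′|w with consecutive-share-edge m→m′
  ...     | s , t , s<t , sm , tm , sm′ , tm′
            with In2-sorted (proj₁ uv) s<t (common-vertex-on-edge uv w′|w w′m′ wm sm sm′)
                                           (common-vertex-on-edge uv w′|w w′m′ wm tm tm′)
  ...       | refl , refl = ⊥-elim (¬uv (sm′ , tm′))

  -- If x lies in T_a but not on the edge uv shared with T_(a+1), then uv
  -- separates x from every later triangle.
  fan-step : ∀ {a a′ b x} → Next a a′ → a′ ≤ b → x ∈T a → x ∈T b → x ∈T a′
  fan-step {a} {a′} {b} {x} a→a′ a′≤b xa xb with consecutive-share-edge a→a′
  ... | u , v , u<v , ua , va , ua′ , va′ with x ≟ u | x ≟ v
  ...   | yes refl | _        = ua′
  ...   | no _     | yes refl = va′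
  ...   | no x≢u   | no x≢v   with vertex-avoiding a′ u v
  ...     | d , da′ , d≢u , d≢v = beyond-b (Fin-walk Beyond a′≤b (d , da′ , x|d) step)
    where
    uv = triangle-edge ua va u<v
    x|d = apexes-separated (<⇒≢ (Next⇒< a→a′)) u<v ua va ua′ va′ xa da′ x≢u x≢v d≢u d≢v
    Beyond : Fin k → Set
    Beyond m = ∃ λ w → w ∈T m × Separates u v x w
    step : ∀ {m m′} → Next m m′ → a′ ≤ m → m′ ≤ b → Beyond m → Beyond m′
    step {m} {m′} m→m′ a′≤m _ (w , wm , x|w) = separation-persists uv m→m′ ¬uv x|w wm
      where
      a′<m′ : a′ < m′
      a′<m′ = ℕₚ.≤-<-trans a′≤m (Next⇒< m→m′)
      ¬uv : ¬ (u ∈T m′ × v ∈T m′)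
      ¬uv (um′ , vm′)
        with sharing-edge⇒consecutive (<⇒≢ (<-trans (Next⇒< a→a′) a′<m′)) (<⇒≢ u<v) ua va um′ vm′
      ... | inj₁ a→m′ = <⇒≢ a′<m′ (Next-unique a→a′ a→m′)
      ... | inj₂ m′→a = <-asym (<-trans (Next⇒< a→a′) a′<m′) (Next⇒< m′→a)
    beyond-b : Beyond b → x ∈T a′
    beyond-b (w , wb , x|w) = ⊥-elim (triangle-not-separated uv xb wb x|w)

  fan-interval : ∀ {a b m x} → x ∈T a → x ∈T b → a ≤ m → m ≤ b → x ∈T m
  fan-interval {x = x} xa xb a≤m m≤b =
    Fin-walk (x ∈T_) a≤m xa λ i→j _ j≤m xi → fan-step i→j (ℕₚ.≤-trans j≤m m≤b) xi xb

  index-member : ∀ {i a b c x} → tri i ≡ (a , b , c) → In3 x a b c → x ∈T i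
  index-member {x = x} tri-i = subst (λ (a , b , c) → In3 x a b c) (sym tri-i)

module Colouring {n : ℕ} (M : MaxPathLikeMap n) (R : Realizer M) (col : AngleCol M)
                 (induced : InducedBy M R col) where
  open MaxPathLikeMap M
  open Realizer R
  open Geometry M
  module ⇔ {ℓ} = IsEquivalence (⇔-isEquivalence {ℓ})

  colour : Fin n → Fin k → Fin 3
  colour u i = col u (A i) (B i) (C i)

  face : Fin k → Elem M
  face i = F (A i) (B i) (C i)

  vertex-below-face : ∀ c {x j} → x ∈T j → rank c (V x) ℕ.< rank c (face j)
  vertex-below-face c {j = j} xj = extension c _ _ tt (tri-face j) (vf xj)

  edge-below-face : ∀ c {a b j} → a < b → a ∈T j → b ∈T j → rank c (E a b) ℕ.< rank c (face j)
  edge-below-face c {j = j} a<b aj bj = extension c _ _ (triangle-edge aj bj a<b) (tri-face j) (ef aj bj)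

  endpoint-below-edge : ∀ c {a b x} → Edge a b → In2 x a b → rank c (V x) ℕ.< rank c (E a b)
  endpoint-below-edge c ab (inj₁ refl) = extension c _ _ tt ab ve₁
  endpoint-below-edge c ab (inj₂ refl) = extension c _ _ tt ab ve₂

  vertex-below-outer : ∀ c {x} → rank c (V x) ℕ.< rank c O
  vertex-below-outer c = extension c _ _ tt tt vo

  critical-edge-below-corner : ∀ {i u v w} → u ∈T i → v ∈T i → w ∈T i → v < w → v ≢ u → w ≢ u →
                               CycEdge v w → rank (colour u i) (E v w) ℕ.< rank (colour u i) (V u)
  critical-edge-below-corner {i} ui vi wi v<w v≢u w≢u =
    proj₁ (induced _ _ _ _ (tri-face i) ui _ _ v<w vi wi v≢u w≢u)

  critical-face-below-corner : ∀ {i j u v w} → u ∈T i → v ∈T i → w ∈T i → v ≢ w → v ≢ u → w ≢ u →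
                               v ∈T j → w ∈T j → j ≢ i → rank (colour u i) (face j) ℕ.< rank (colour u i) (V u)
  critical-face-below-corner {i} {j} {v = v} {w} ui vi wi v≢w v≢u w≢u vj wj j≢i with <-cmp v w
  ... | tri< v<w _ _  = proj₂ (induced _ _ _ _ (tri-face i) ui _ _ v<w vi wi v≢u w≢u)
                          (shared-edge-chord (j≢i ∘ sym) v<w vi wi vj wj) _ _ _ (tri-face j) vj wj (j≢i ∘ tri-inj j i)
  ... | tri≈ _ v≡w _ = ⊥-elim (v≢w v≡w)
  ... | tri> _ _ w<v  = proj₂ (induced _ _ _ _ (tri-face i) ui _ _ w<v wi vi w≢u v≢u)
                          (shared-edge-chord (j≢i ∘ sym) w<v wi vi wj vj) _ _ _ (tri-face j) wj vj (j≢i ∘ tri-inj j i)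

  -- The critical pair of u (the edge ab, or the face across the chord ab) lies
  -- above the endpoints of ab and below u.
  opposite-edge-below-corner : ∀ {i u a b x} → u ∈T i → a ∈T i → b ∈T i → a < b → a ≢ u → b ≢ u →
                               In2 x a b → rank (colour u i) (V x) ℕ.< rank (colour u i) (V u)
  opposite-edge-below-corner {i} {u} {a} {b} {x} ui ai bi a<b a≢u b≢u x∈ab =
    decidable-stable (_ ℕₚ.<? _) λ not-below → via not-below (proj₂ (triangle-edge ai bi a<b))
    where
    c = colour u i
    via : ¬ (rank c (V x) ℕ.< rank c (V u)) → CycEdge a b ⊎ Chord a b → ⊥
    via not-below (inj₁ ab) =
      not-below (ℕₚ.<-trans (endpoint-below-edge c (triangle-edge ai bi a<b) x∈ab)
                            (critical-edge-below-corner ui ai bi a<b a≢u b≢u ab))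
    via not-below (inj₂ ab) = chord-second-triangle ab ai bi λ (j , j≢i , aj , bj) →
      not-below (ℕₚ.<-trans (vertex-below-face c ([ (λ { refl → aj }) , (λ { refl → bj }) ]′ x∈ab))
                            (critical-face-below-corner ui ai bi (<⇒≢ a<b) a≢u b≢u aj bj j≢i))

  corner-on-top : ∀ {i u v} → u ∈T i → v ∈T i → u ≢ v → rank (colour u i) (V v) ℕ.< rank (colour u i) (V u)
  corner-on-top {i} {u} {v} ui vi u≢v with vertex-avoiding i u v
  ... | w , wi , w≢u , w≢v with <-cmp v w
  ...   | tri< v<w _ _  = opposite-edge-below-corner ui vi wi v<w (≢-sym u≢v) w≢u (inj₁ refl)
  ...   | tri≈ _ v≡w _ = ⊥-elim (w≢v (sym v≡w))
  ...   | tri> _ _ w<v  = opposite-edge-below-corner ui wi vi w<v w≢u (≢-sym u≢v) (inj₂ refl)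

  corner-colours-distinct : ∀ {i j u v} → u ≢ v → u ∈T i → v ∈T i → u ∈T j → v ∈T j → colour u i ≢ colour v j
  corner-colours-distinct {u = u} {v} u≢v ui vi uj vj same =
    ℕₚ.<-asym (corner-on-top ui vi u≢v)
              (subst (λ c → rank c (V u) ℕ.< rank c (V v)) (sym same) (corner-on-top vj uj (≢-sym u≢v)))

  triangle-colours : ∀ {i u v w} → u ≢ v → u ≢ w → v ≢ w → u ∈T i → v ∈T i → w ∈T i →
                     ∀ c → In3 c (colour u i) (colour v i) (colour w i)
  triangle-colours u≢v u≢w v≢w ui vi wi =
    Fin3-exhausted (corner-colours-distinct u≢v ui vi ui vi) (corner-colours-distinct u≢w ui wi ui wi)
                   (corner-colours-distinct v≢w vi wi vi wi)

  -- In the common colour m the two faces would sit below each other's apex: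
  -- face j < V c < face i < V d < face j.
  apex-colours-distinct : ∀ {i j p q c d} → i ≢ j → p ≢ q → p ∈T i → q ∈T i → p ∈T j → q ∈T j →
                          c ∈T i → d ∈T j → c ≢ p → c ≢ q → d ≢ p → d ≢ q → colour c i ≢ colour d j
  apex-colours-distinct {i} {j} {c = c} {d} i≢j p≢q pi qi pj qj ci dj c≢p c≢q d≢p d≢q same =
    ℕₚ.<-irrefl refl
      (ℕₚ.<-trans (critical-face-below-corner ci pi qi p≢q (≢-sym c≢p) (≢-sym c≢q) pj qj (i≢j ∘ sym))
      (ℕₚ.<-trans (vertex-below-face (colour c i) ci)
      (ℕₚ.<-trans (subst (λ m → rank m (face i) ℕ.< rank m (V d)) (sym same)
                         (critical-face-below-corner dj pj qj p≢q (≢-sym d≢p) (≢-sym d≢q) pi qi i≢j))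
                  (vertex-below-face (colour c i) dj))))

  chord-colour-repeats : ∀ {i j a b} → i ≢ j → a ≢ b → a ∈T i → b ∈T i → a ∈T j → b ∈T j →
                         colour a i ≡ colour a j ⊎ colour b i ≡ colour b j
  chord-colour-repeats {i} {j} {a} {b} i≢j a≢b ai bi aj bj with colour a i ≟ colour a j | colour b i ≟ colour b j
  ... | yes a-same | _          = inj₁ a-same
  ... | no _       | yes b-same = inj₂ b-same
  ... | no a-moved | no b-moved with vertex-avoiding j a b
  ...   | d , dj , d≢a , d≢b = ⊥-elim (corner-colours-distinct a≢b ai bi ai bi (trans a↦d (sym b↦d)))
    where
    in-j = triangle-colours a≢b (≢-sym d≢a) (≢-sym d≢b) aj bj dj
    a↦d : colour a i ≡ colour d j
    a↦d = In3-third (in-j _) a-moved (corner-colours-distinct a≢b ai bi aj bj)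
    b↦d : colour b i ≡ colour d j
    b↦d = In3-third (in-j _) (corner-colours-distinct (≢-sym a≢b) bi ai bj aj) b-moved

  chord-colour-repeats-once : ∀ {i j a b} → i ≢ j → a ≢ b → a ∈T i → b ∈T i → a ∈T j → b ∈T j →
                              colour a i ≡ colour a j → colour b i ≢ colour b j
  chord-colour-repeats-once {i} {j} {a} {b} i≢j a≢b ai bi aj bj a-same b-same
    with vertex-avoiding i a b | vertex-avoiding j a b
  ... | c , ci , c≢a , c≢b | d , dj , d≢a , d≢b
    with triangle-colours a≢b (≢-sym d≢a) (≢-sym d≢b) aj bj dj (colour c i)
  ...   | inj₁ c↦a        = corner-colours-distinct c≢a ci ai ci ai (trans c↦a (sym a-same))
  ...   | inj₂ (inj₁ c↦b) = corner-colours-distinct c≢b ci bi ci bi (trans c↦b (sym b-same))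
  ...   | inj₂ (inj₂ c↦d) = apex-colours-distinct i≢j a≢b ai bi aj bj ci dj c≢a c≢b d≢a d≢b c↦d

  Towards : Fin n → Fin k → Fin k → Set
  Towards x i j = colour x i ≡ colour x j

  shared-edge-not-below-outer : ∀ {i j a b} → i ≢ j → a < b → a ∈T i → b ∈T i → a ∈T j → b ∈T j →
                                ¬ (∀ c → rank c (E a b) ℕ.< rank c O)
  shared-edge-not-below-outer i≢j a<b ai bi aj bj below
    with realizes _ _ (triangle-edge ai bi a<b) tt below
  ... | eo ab = chord-notCycle (shared-edge-chord i≢j a<b ai bi aj bj) ab

  -- The colours α, β, γ of x, p, q in t are forced onto the apex p′ of tp,
  -- onto p in t and onto the apex q′ of tq; each of these corners lies above
  -- a face containing xq, so xq would precede the outer face in every order.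
  not-towards-propagates : ∀ {t tp tq x p q} → tp ≢ t → tq ≢ t → x ≢ p → x ≢ q → p ≢ q →
                           x ∈T t → p ∈T t → q ∈T t → x ∈T tp → p ∈T tp → x ∈T tq → q ∈T tq →
                           ¬ Towards x tp t → ¬ Towards x t tq
  not-towards-propagates {t} {tp} {tq} {x} {p} {q} tp≢t tq≢t x≢p x≢q p≢q xt pt qt xtp ptp xtq qtq away towards
    with vertex-avoiding tp x p | vertex-avoiding tq x q
  ... | p′ , p′tp , p′≢x , p′≢p | q′ , q′tq , q′≢x , q′≢q = by-order (<-cmp x q)
    where
    α = colour x t
    β = colour p t
    γ = colour q t
    in-t = triangle-colours x≢p x≢q p≢q xt pt qt
    q↦β : colour q tq ≡ β
    q↦β = In3-second (in-t _) (λ e → corner-colours-distinct (≢-sym x≢q) qtq xtq qtq xtq (trans e towards))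
                              (chord-colour-repeats-once (tq≢t ∘ sym) x≢q xt qt xtq qtq towards ∘ sym)
    q′↦γ : colour q′ tq ≡ γ
    q′↦γ = In3-third (in-t _) (λ e → corner-colours-distinct q′≢x q′tq xtq q′tq xtq (trans e towards))
                              (λ e → corner-colours-distinct q′≢q q′tq qtq q′tq qtq (trans e (sym q↦β)))
    p↦β : colour p tp ≡ β
    p↦β = [ ⊥-elim ∘ away , id ]′ (chord-colour-repeats tp≢t x≢p xtp ptp xt pt)
    x↦γ : colour x tp ≡ γ
    x↦γ = In3-third (in-t _) away (λ e → corner-colours-distinct x≢p xtp ptp xtp ptp (trans e (sym p↦β)))
    p′↦α : colour p′ tp ≡ α
    p′↦α = In3-first (in-t _) (λ e → corner-colours-distinct p′≢p p′tp ptp p′tp ptp (trans e (sym p↦β)))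
                              (λ e → corner-colours-distinct p′≢x p′tp xtp p′tp xtp (trans e (sym x↦γ)))
    open ℕₚ.≤-Reasoning
    xq-below-outer : ∀ {a b} → a < b → a ∈T t → b ∈T t → a ∈T tq → b ∈T tq → ∀ c → rank c (E a b) ℕ.< rank c O
    xq-below-outer {a} {b} a<b at bt atq btq c with in-t c
    ... | inj₁ refl = begin-strict
      rank α (E a b)  <⟨ edge-below-face α a<b at bt ⟩
      rank α (face t) <⟨ subst (λ m → rank m (face t) ℕ.< rank m (V p′)) p′↦α
                           (critical-face-below-corner p′tp xtp ptp x≢p (≢-sym p′≢x) (≢-sym p′≢p) xt pt (tp≢t ∘ sym)) ⟩
      rank α (V p′)   <⟨ vertex-below-outer α ⟩
      rank α O        ∎
    ... | inj₂ (inj₁ refl) = begin-strict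
      rank β (E a b)   <⟨ edge-below-face β a<b atq btq ⟩
      rank β (face tq) <⟨ critical-face-below-corner pt xt qt x≢q x≢p (≢-sym p≢q) xtq qtq tq≢t ⟩
      rank β (V p)     <⟨ vertex-below-outer β ⟩
      rank β O         ∎
    ... | inj₂ (inj₂ refl) = begin-strict
      rank γ (E a b)  <⟨ edge-below-face γ a<b at bt ⟩
      rank γ (face t) <⟨ subst (λ m → rank m (face t) ℕ.< rank m (V q′)) q′↦γ
                           (critical-face-below-corner q′tq xtq qtq x≢q (≢-sym q′≢x) (≢-sym q′≢q) xt qt (tq≢t ∘ sym)) ⟩
      rank γ (V q′)   <⟨ vertex-below-outer γ ⟩
      rank γ O        ∎
    by-order : Tri (x < q) (x ≡ q) (q < x) → ⊥
    by-order (tri< x<q _ _) =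
      shared-edge-not-below-outer (tq≢t ∘ sym) x<q xt qt xtq qtq (xq-below-outer x<q xt qt xtq qtq)
    by-order (tri≈ _ x≡q _) = x≢q x≡q
    by-order (tri> _ _ q<x) =
      shared-edge-not-below-outer (tq≢t ∘ sym) q<x qt xt qtq xtq (xq-below-outer q<x qt xt qtq xtq)

  towards-steady : ∀ {l l′ l″ x} → Next l l′ → Next l′ l″ → x ∈T l → x ∈T l′ → x ∈T l″ →
                   Towards x l l′ ⇔ Towards x l′ l″
  towards-steady {l} {l′} {l″} {x} l→l′ l′→l″ xl xl′ xl″
    with consecutive-share-edge-at l→l′ xl xl′ | consecutive-share-edge-at l′→l″ xl′ xl″
  ... | p , p≢x , pl , pl′ | q , q≢x , ql′ , ql″ = mk⇔ forward backward
    where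
    l′≢l = <⇒≢ (Next⇒< l→l′) ∘ sym
    l″≢l′ = <⇒≢ (Next⇒< l′→l″) ∘ sym
    l<l″ = <-trans (Next⇒< l→l′) (Next⇒< l′→l″)
    p≢q : p ≢ q
    p≢q refl with sharing-edge⇒consecutive (<⇒≢ l<l″) (≢-sym p≢x) xl pl xl″ ql″
    ... | inj₁ l→l″ = <⇒≢ (Next⇒< l′→l″) (Next-unique l→l′ l→l″)
    ... | inj₂ l″→l = <-asym l<l″ (Next⇒< l″→l)
    forward : Towards x l l′ → Towards x l′ l″
    forward towards with colour x l′ ≟ colour x l″
    ... | yes steady = steady
    ... | no moved = ⊥-elim (not-towards-propagates l″≢l′ (l′≢l ∘ sym) (≢-sym q≢x) (≢-sym p≢x) (≢-sym p≢q)
                               xl′ ql′ pl′ xl″ ql″ xl pl (moved ∘ sym) (sym towards))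
    backward : Towards x l′ l″ → Towards x l l′
    backward towards with colour x l ≟ colour x l′
    ... | yes steady = steady
    ... | no moved = ⊥-elim (not-towards-propagates (l′≢l ∘ sym) l″≢l′ (≢-sym p≢x) (≢-sym q≢x) p≢q
                               xl′ pl′ ql′ xl pl xl″ ql″ moved towards)

  towards-uniform : ∀ {i i′ j j′ x} → Next i i′ → Next j j′ → i ≤ j → x ∈T i → x ∈T j′ →
                    Towards x i i′ ⇔ Towards x j j′
  towards-uniform {i} {i′} {j} {j′} {x} i→i′ j→j′ i≤j xi xj′ = Fin-walk Settled i≤j start step j→j′
    where
    Settled : Fin k → Set
    Settled m = ∀ {m′} → Next m m′ → Towards x i i′ ⇔ Towards x m m′
    start : Settled i
    start i→m′ = subst (λ m′ → Towards x i i′ ⇔ Towards x i m′) (Next-unique i→i′ i→m′) ⇔.refl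
    j<j′ = Next⇒< j→j′
    step : ∀ {m m₁} → Next m m₁ → i ≤ m → m₁ ≤ j → Settled m → Settled m₁
    step m→m₁ i≤m m₁≤j settled m₁→m₂ =
      ⇔.trans (settled m→m₁)
              (towards-steady m→m₁ m₁→m₂ (in-fan i≤m m≤j′) (in-fan i≤m₁ (ℕₚ.<⇒≤ m₁<j′)) (in-fan i≤m₂ m₂≤j′))
      where
      in-fan : ∀ {y} → i ≤ y → y ≤ j′ → x ∈T y
      in-fan i≤y y≤j′ = fan-interval xi xj′ i≤y y≤j′
      m₁<j′ = ℕₚ.≤-<-trans m₁≤j j<j′
      m≤j′ = ℕₚ.<⇒≤ (<-trans (Next⇒< m→m₁) m₁<j′)
      i≤m₁ = ℕₚ.<⇒≤ (ℕₚ.≤-<-trans i≤m (Next⇒< m→m₁))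
      i≤m₂ = ℕₚ.<⇒≤ (ℕₚ.≤-<-trans i≤m (<-trans (Next⇒< m→m₁) (Next⇒< m₁→m₂)))
      m₂≤j′ = subst₂ ℕ._≤_ m₁→m₂ j→j′ (ℕ.s≤s m₁≤j)

  towards-flip : ∀ {x i j} → Towards x i j ⇔ Towards x j i
  towards-flip = mk⇔ sym sym

  towards-uniform-consecutive : ∀ {i i′ j j′ x} → Next i i′ → Next j j′ → x ∈T i → x ∈T i′ → x ∈T j → x ∈T j′ →
                                Towards x i i′ ⇔ Towards x j j′
  towards-uniform-consecutive {i} {j = j} i→i′ j→j′ xi xi′ xj xj′ with ℕₚ.≤-total (toℕ i) (toℕ j)
  ... | inj₁ i≤j = towards-uniform i→i′ j→j′ i≤j xi xj′
  ... | inj₂ j≤i = ⇔.sym (towards-uniform j→j′ i→i′ j≤i xj xi′)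

  towards-uniform-adjacent : ∀ {i i′ j j′ x} → Next i i′ ⊎ Next i′ i → Next j j′ ⊎ Next j′ j →
                             x ∈T i → x ∈T i′ → x ∈T j → x ∈T j′ → Towards x i i′ ⇔ Towards x j j′
  towards-uniform-adjacent (inj₁ i→i′) (inj₁ j→j′) xi xi′ xj xj′ = towards-uniform-consecutive i→i′ j→j′ xi xi′ xj xj′
  towards-uniform-adjacent (inj₁ i→i′) (inj₂ j′→j) xi xi′ xj xj′ =
    ⇔.trans (towards-uniform-consecutive i→i′ j′→j xi xi′ xj′ xj) towards-flip
  towards-uniform-adjacent (inj₂ i′→i) (inj₁ j→j′) xi xi′ xj xj′ =
    ⇔.trans towards-flip (towards-uniform-consecutive i′→i j→j′ xi′ xi xj xj′)
  towards-uniform-adjacent (inj₂ i′→i) (inj₂ j′→j) xi xi′ xj xj′ =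
    ⇔.trans towards-flip (⇔.trans (towards-uniform-consecutive i′→i j′→j xi′ xi xj′ xj) towards-flip)

  -- The chord xy is oriented away from x and the chord xz towards x.
  not-source-and-sink : ∀ {x y z i₁ i₂ j₁ j₂} → y ≢ x → z ≢ x →
                        i₁ ≢ i₂ → x ∈T i₁ → y ∈T i₁ → x ∈T i₂ → y ∈T i₂ → ¬ Towards x i₁ i₂ →
                        j₁ ≢ j₂ → x ∈T j₁ → z ∈T j₁ → x ∈T j₂ → z ∈T j₂ → ¬ Towards z j₁ j₂ → ⊥
  not-source-and-sink y≢x z≢x i₁≢i₂ xi₁ yi₁ xi₂ yi₂ away j₁≢j₂ xj₁ zj₁ xj₂ zj₂ z-moved =
    away (Equivalence.from (towards-uniform-adjacent (sharing-edge⇒consecutive i₁≢i₂ (≢-sym y≢x) xi₁ yi₁ xi₂ yi₂)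
                                                    (sharing-edge⇒consecutive j₁≢j₂ (≢-sym z≢x) xj₁ zj₁ xj₂ zj₂)
                                                    xi₁ xi₂ xj₁ xj₂)
                           ([ id , ⊥-elim ∘ z-moved ]′ (chord-colour-repeats j₁≢j₂ (≢-sym z≢x) xj₁ zj₁ xj₂ zj₂)))

  -- Decidable form of Sink: chords at x are reached through the pairs of
  -- triangles sharing them.
  AllTowards : Fin n → Set
  AllTowards x = ∀ y i j → y ≢ x → i ≢ j → x ∈T i → y ∈T i → x ∈T j → y ∈T j → Towards x i j

  all-towards? : ∀ x → Dec (AllTowards x)
  all-towards? x = all? λ y → all? λ i → all? λ j →
    ¬? (y ≟ x) →-dec ¬? (i ≟ j) →-dec x ∈T? i →-dec y ∈T? i →-dec x ∈T? j →-dec y ∈T? j →-dec colour x i ≟ colour x j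
    where
    _∈T?_ : ∀ v l → Dec (v ∈T l)
    v ∈T? l = v ≟ A l ⊎-dec v ≟ B l ⊎-dec v ≟ C l

  oriented-towards : ∀ {x y} → (∀ {i j} → i ≢ j → x ∈T i → y ∈T i → x ∈T j → y ∈T j → Towards x i j) →
                     OrientedTowards M col x y
  oriented-towards {x} towards a b c a′ b′ c′ t t′ xt yt xt′ yt′ t≢t′ with tri-onto a b c t | tri-onto a′ b′ c′ t′
  ... | i , tri-i | j , tri-j = begin
    col x a b c    ≡⟨ cong (λ (a , b , c) → col x a b c) tri-i ⟨
    colour x i     ≡⟨ towards i≢j (index-member tri-i xt) (index-member tri-i yt)
                                  (index-member tri-j xt′) (index-member tri-j yt′) ⟩
    colour x j     ≡⟨ cong (λ (a , b , c) → col x a b c) tri-j ⟩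
    col x a′ b′ c′ ∎
    where
    open ≡-Reasoning
    i≢j : i ≢ j
    i≢j refl = t≢t′ (trans (sym tri-i) tri-j)

  chord-endpoints-distinct : ∀ {x y} → ChordAt M x y → y ≢ x
  chord-endpoints-distinct (inj₁ xy) = <⇒≢ (chord-sorted xy) ∘ sym
  chord-endpoints-distinct (inj₂ yx) = <⇒≢ (chord-sorted yx)

lemma3p8 : ∀ {n : ℕ} (M : MaxPathLikeMap n) (R : Realizer M) (col : AngleCol M) →
           InducedBy M R col →
           ∀ (x : Fin n) → Sink M col x ⊎ Source M col x
lemma3p8 M R col induced x = sink-or-source (all-towards? x)
  where
  open Colouring M R col induced
  sink-or-source : Dec (AllTowards x) → Sink M col x ⊎ Source M col x
  sink-or-source (yes all-towards) =
    inj₁ λ y xy → oriented-towards (all-towards y _ _ (chord-endpoints-distinct xy))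
  sink-or-source (no not-all-towards) =
    inj₂ λ y xy → oriented-towards λ {i} {j} i≢j yi xi yj xj →
      decidable-stable (colour y i ≟ colour y j) λ y-moved →
        not-all-towards λ z l l′ z≢x l≢l′ xl zl xl′ zl′ →
          decidable-stable (colour x l ≟ colour x l′) λ away →
            not-source-and-sink z≢x (chord-endpoints-distinct xy) l≢l′ xl zl xl′ zl′ away i≢j xi yi xj yj y-moved
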